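{- If $D$ is a digraph whose underlying graph has chromatic number $k\ge 3$, then ${\rm ndi}(D)\le\Delta^*(D)+2\lceil \log k\rceil$.
   Context: Here $\log$ denotes the logarithm in base 2. All digraphs are finite, without loops and without multiple arcs (opposite arcs allowed). The underlying graph of $D$ is the simple undirected graph obtained by replacing each arc $uv$ (or each pair of arcs $uv,vu$) by the edge $uv$. $\Delta^*(D)$ is the maximum of the maximum outdegree and the maximum indegree of $D$. A (proper) $k$-arc-colouring of $D$ is a map $\gamma$ from $A(D)$ to a set of $k$ colours such that arcs with the same head get distinct colours and arcs with the same tail get distinct colours. $S_\gamma^+(u)$, $S_\gamma^-(u)$ are the sets of colours on arcs with tail $u$, resp. head $u$. $\gamma$ is neighbour-distinguishing if for every arc $uv$, $(S_\gamma^+(u),S_\gamma^-(u))\neq(S_\gamma^+(v),S_\gamma^-(v))$ as ordered pairs. ${\rm ndi}(D)$ is the minimum number of colours of a neighbour-distinguishing arc-colouring of $D$. -}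

module Defs where

open import Data.Nat using (ℕ; _⊔_; _<_)
open import Data.Bool using (Bool; true; false; _∨_)
open import Data.Fin using (Fin)
open import Data.List using (List; map; foldr; filter; length)
open import Data.List using (allFin)
open import Data.Product using (Σ; _×_)
open import Relation.Binary.PropositionalEquality using (_≡_; _≢_)
open import Relation.Nullary using (¬_)
open import Data.Bool.Properties using (T?)
open import Data.Bool using (T)
open import Function.Bundles using (_⇔_)

-- A finite digraph on vertex set Fin n: arcs given by a Boolean adjacency
-- relation, no loops (opposite arcs allowed, no multiple arcs automatically).
record Digraph : Set where
  field
    n        : ℕ
    arc      : Fin n → Fin n → Bool
    loopless : ∀ u → arc u u ≡ false
open Digraph public

Arc : (D : Digraph) → Fin (n D) → Fin (n D) → Set
Arc D u v = arc D u v ≡ true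

outdeg : (D : Digraph) → Fin (n D) → ℕ
outdeg D u = length (filter (λ v → T? (arc D u v)) (allFin (n D)))

indeg : (D : Digraph) → Fin (n D) → ℕ
indeg D u = length (filter (λ v → T? (arc D v u)) (allFin (n D)))

Δ* : Digraph → ℕ
Δ* D = foldr _⊔_ 0 (map (λ u → outdeg D u ⊔ indeg D u) (allFin (n D)))

-- underlying (simple undirected) graph: u ~ v iff uv or vu is an arc
Edge : (D : Digraph) → Fin (n D) → Fin (n D) → Set
Edge D u v = (arc D u v ∨ arc D v u) ≡ true

Colourable : Digraph → ℕ → Set
Colourable D k = Σ (Fin (n D) → Fin k) λ c → ∀ u v → Edge D u v → c u ≢ c v

HasChromaticNumber : Digraph → ℕ → Set
HasChromaticNumber D k = Colourable D k × (∀ j → j < k → ¬ Colourable D j)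

-- an arc-colouring with colour set Fin c (values on non-arcs are irrelevant)
ArcColouring : Digraph → ℕ → Set
ArcColouring D c = Fin (n D) → Fin (n D) → Fin c

Proper : (D : Digraph) {c : ℕ} → ArcColouring D c → Set
Proper D γ =
  (∀ u v w → Arc D u v → Arc D u w → v ≢ w → γ u v ≢ γ u w) ×
  (∀ u v w → Arc D u w → Arc D v w → u ≢ v → γ u w ≢ γ v w)

InS⁺ : (D : Digraph) {c : ℕ} → ArcColouring D c → Fin (n D) → Fin c → Set
InS⁺ D γ u a = Σ (Fin (n D)) λ v → Arc D u v × γ u v ≡ a

InS⁻ : (D : Digraph) {c : ℕ} → ArcColouring D c → Fin (n D) → Fin c → Set
InS⁻ D γ u a = Σ (Fin (n D)) λ v → Arc D v u × γ v u ≡ a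

SamePair : (D : Digraph) {c : ℕ} → ArcColouring D c → Fin (n D) → Fin (n D) → Set
SamePair D {c} γ u v =
  (∀ (a : Fin c) → InS⁺ D γ u a ⇔ InS⁺ D γ v a) ×
  (∀ (a : Fin c) → InS⁻ D γ u a ⇔ InS⁻ D γ v a)

NeighbourDistinguishing : (D : Digraph) {c : ℕ} → ArcColouring D c → Set
NeighbourDistinguishing D γ = ∀ u v → Arc D u v → ¬ SamePair D γ u v

-- ndi(D) ≤ m  :⇔  D has a neighbour-distinguishing m-arc-colouring
ndi≤ : Digraph → ℕ → Set
ndi≤ D m = Σ (ArcColouring D m) λ γ → Proper D γ × NeighbourDistinguishing D γ

module Submission where

-- Let p = ⌈log₂ k⌉ and let c be a proper k-colouring of the underlying graph,
-- so that every c(x) is a p-digit binary number.  Label each arc xy by the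
-- pair (i , i-th digit of c(x)), where i is the lowest digit in which c(x)
-- and c(y) differ.  There are 2p labels, and two consecutive arcs wu, uv
-- never carry the same label: they would agree on digit i of c(w) and c(u).
-- Finally the arcs of M are coloured Δ* + label and all other arcs by κ.  If
-- an arc uv had S⁺(u) = S⁺(v) and S⁻(u) = S⁻(v), the colour of the arc of M
-- representing uv would reappear at v (resp. u) on an arc of M with the same
-- label, consecutive to uv.

open import Defs
open import Data.Nat using (ℕ; zero; suc; _+_; _*_; _≤_)
open import Data.Nat using (_∸_; _^_; _<_; _⊔_; _/_; _%_; ⌈_/2⌉; ⌊_/2⌋; z≤n; s≤s; NonZero; >-nonZero)
open import Data.Nat.Properties
open import Data.Nat.DivMod using (m≡m%n+[m/n]*n; m%n<n; m<n*o⇒m/o<n; _mod_; m<n⇒m%n≡m)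
open import Data.Nat.Logarithm using (⌈log₂_⌉)
open import Data.Nat.Logarithm.Core using (⌈log2⌉)
open import Data.Nat.Induction using (<-wellFounded)
open import Data.Nat.Tactic.RingSolver using (solve-∀)
open import Induction.WellFounded using (Acc; acc)
open import Data.Fin using (Fin; zero; suc; toℕ; fromℕ<; combine; remQuot) renaming (_≟_ to _≟ᶠ_)
open import Data.Fin.Properties
  using (any?; all?; ¬∀⟶∃¬; injective⇒≤; toℕ<n; toℕ-injective; toℕ-fromℕ<; combine-remQuot; combine-injective; pigeonhole)
  renaming (suc-injective to fsuc-injective)
open import Data.Bool using (Bool; true; false; T; if_then_else_; _∨_)
open import Data.Bool.Properties using (T?; T-≡) renaming (_≟_ to _≟ᵇ_)
open import Function.Bundles using (Equivalence)
open import Data.List using (List; _∷_; foldr; filter; length; allFin)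
open import Data.List.Membership.Propositional using (_∈_)
open import Data.List.Membership.Propositional.Properties using (∈-map⁺; ∈-allFin; ∈-filter⁺)
open import Data.List.Relation.Unary.Any using (here; there; index)
open import Data.Product using (∃; ∃₂; _×_; _,_; proj₁; proj₂; uncurry)
open import Data.Sum using (_⊎_; inj₁; inj₂)
open import Data.Empty using (⊥; ⊥-elim)
open import Relation.Nullary using (¬_; Dec; yes; no; does)
open import Relation.Nullary.Decidable using (_×-dec_; _⊎-dec_; dec-true; dec-false)
open import Data.Maybe using (Maybe; just; nothing; _>>=_)
import Data.Maybe.Properties as Maybe
import Data.Product.Properties as Product
open import Relation.Binary.Core using (_⇒_)
open import Relation.Binary.PropositionalEquality

n≤⌈n/2⌉+⌈n/2⌉ : ∀ n → n ≤ ⌈ n /2⌉ + ⌈ n /2⌉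
n≤⌈n/2⌉+⌈n/2⌉ n = begin
  n                     ≡⟨ ⌊n/2⌋+⌈n/2⌉≡n n ⟨
  ⌊ n /2⌋ + ⌈ n /2⌉     ≤⟨ +-monoˡ-≤ ⌈ n /2⌉ (⌊n/2⌋≤⌈n/2⌉ n) ⟩
  ⌈ n /2⌉ + ⌈ n /2⌉     ∎
  where open ≤-Reasoning

-- ⌈log₂ k⌉ binary digits suffice for the numbers below k; by the recursion
-- ⌈log₂ (2 + m)⌉ = 1 + ⌈log₂ (1 + ⌈m/2⌉)⌉ defining the logarithm.
≤2^⌈log2⌉ : ∀ k (rec : Acc _<_ k) → k ≤ 2 ^ ⌈log2⌉ k rec
≤2^⌈log2⌉ 0 _ = z≤n
≤2^⌈log2⌉ 1 _ = s≤s z≤n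
≤2^⌈log2⌉ (suc (suc m)) (acc rs) = begin
  2 + m                        ≤⟨ +-monoʳ-≤ 2 (n≤⌈n/2⌉+⌈n/2⌉ m) ⟩
  2 + (⌈ m /2⌉ + ⌈ m /2⌉)      ≡⟨ double-suc ⌈ m /2⌉ ⟩
  2 * suc ⌈ m /2⌉              ≤⟨ *-monoʳ-≤ 2 (≤2^⌈log2⌉ (suc ⌈ m /2⌉) (rs (⌈n/2⌉<n m))) ⟩
  2 * 2 ^ ⌈log2⌉ (suc ⌈ m /2⌉) _ ∎
  where
  open ≤-Reasoning
  double-suc : ∀ h → 2 + (h + h) ≡ 2 * suc h
  double-suc = solve-∀

≤2^⌈log₂⌉ : ∀ k → k ≤ 2 ^ ⌈log₂ k ⌉
≤2^⌈log₂⌉ k = ≤2^⌈log2⌉ k (<-wellFounded k)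

bit : ℕ → ℕ → ℕ
bit zero    m = m % 2
bit (suc i) m = bit i (m / 2)

bit<2 : ∀ i m → bit i m < 2
bit<2 zero    m = m%n<n m 2
bit<2 (suc i) m = bit<2 i (m / 2)

firstDiff : ℕ → ℕ → ℕ → ℕ
firstDiff zero    m m' = 0
firstDiff (suc p) m m' with m % 2 ≟ m' % 2
... | yes _ = suc (firstDiff p (m / 2) (m' / 2))
... | no  _ = 0

firstDiff-spec : ∀ p m m' → m < 2 ^ p → m' < 2 ^ p → m ≢ m' →
                 firstDiff p m m' < p × bit (firstDiff p m m') m ≢ bit (firstDiff p m m') m'
firstDiff-spec zero    m m' m<1 m'<1 m≢m' = ⊥-elim (m≢m' (trans (n<1⇒n≡0 m<1) (sym (n<1⇒n≡0 m'<1))))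
firstDiff-spec (suc p) m m' m< m'< m≢m' with m % 2 ≟ m' % 2
... | no  last≢ = s≤s z≤n , last≢
... | yes last≡ = s≤s (proj₁ rest) , proj₂ rest
  where
  halve : ∀ x → x < 2 ^ suc p → x / 2 < 2 ^ p
  halve x x< = m<n*o⇒m/o<n (subst (x <_) (*-comm 2 (2 ^ p)) x<)
  halves-differ : m / 2 ≢ m' / 2
  halves-differ eq = m≢m' (begin
    m                    ≡⟨ m≡m%n+[m/n]*n m 2 ⟩
    m % 2 + m / 2 * 2    ≡⟨ cong₂ (λ r q → r + q * 2) last≡ eq ⟩
    m' % 2 + m' / 2 * 2  ≡⟨ m≡m%n+[m/n]*n m' 2 ⟨
    m'                   ∎)
    where open ≡-Reasoning
  rest = firstDiff-spec p (m / 2) (m' / 2) (halve m m<) (halve m' m'<) halves-differ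

code : ℕ → ℕ → ℕ → ℕ
code p i zero    = i
code p i (suc _) = p + i

code<2p : ∀ p i β → i < p → β < 2 → code p i β < 2 * p
code<2p p i zero          i<p _ = ≤-trans i<p (m≤m+n p _)
code<2p p i (suc zero)    i<p _ = +-monoʳ-< p (≤-trans i<p (m≤m+n p 0))
code<2p p i (suc (suc _)) _ (s≤s (s≤s ()))

code-injective : ∀ p i i' β β' → i < p → i' < p → β < 2 → β' < 2 →
                 code p i β ≡ code p i' β' → i ≡ i' × β ≡ β'
code-injective p i i' zero          zero          _   _    _ _ eq = eq , refl
code-injective p i i' (suc zero)    (suc zero)    _   _    _ _ eq = +-cancelˡ-≡ p i i' eq , refl
code-injective p i i' zero          (suc zero)    i<p _    _ _ eq = ⊥-elim (<⇒≱ i<p (subst (p ≤_) (sym eq) (m≤m+n p i')))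
code-injective p i i' (suc zero)    zero          _   i'<p _ _ eq = ⊥-elim (<⇒≱ i'<p (subst (p ≤_) eq (m≤m+n p i)))
code-injective p i i' (suc (suc _)) _             _   _    (s≤s (s≤s ())) _ _
code-injective p i i' _             (suc (suc _)) _   _    _ (s≤s (s≤s ())) _

module DigitLabels (D : Digraph) (p : ℕ) (c : Fin (n D) → ℕ)
  (c< : ∀ x → c x < 2 ^ p) (c-proper : ∀ x y → Arc D x y → c x ≢ c y) where

  digit : Fin (n D) → Fin (n D) → ℕ
  digit x y = firstDiff p (c x) (c y)

  label : Fin (n D) → Fin (n D) → ℕ
  label x y = code p (digit x y) (bit (digit x y) (c x))

  digit-spec : ∀ x y → Arc D x y → digit x y < p × bit (digit x y) (c x) ≢ bit (digit x y) (c y)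
  digit-spec x y xy = firstDiff-spec p (c x) (c y) (c< x) (c< y) (c-proper x y xy)

  label<2p : ∀ x y → Arc D x y → label x y < 2 * p
  label<2p x y xy = code<2p p (digit x y) _ (proj₁ (digit-spec x y xy)) (bit<2 (digit x y) (c x))

  -- Equal labels on wu and uv would give the same digit i and the same i-th
  -- digit of c w and c u, although i is a digit where c w and c u differ.
  consecutive-labels-differ : ∀ w u v → Arc D w u → Arc D u v → label w u ≢ label u v
  consecutive-labels-differ w u v wu uv eq
    with code-injective p (digit w u) (digit u v) _ _ (proj₁ (digit-spec w u wu)) (proj₁ (digit-spec u v uv))
           (bit<2 (digit w u) (c w)) (bit<2 (digit u v) (c u)) eq
  ... | same-digit , same-bit =
    proj₂ (digit-spec w u wu) (trans same-bit (cong (λ i → bit i (c u)) (sym same-digit)))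

ArcSet : ℕ → Set₁
ArcSet N = Fin N → Fin N → Set

Add : ∀ {N} → ArcSet N → Fin N → Fin N → ArcSet N
Add R u v x y = R x y ⊎ (x ≡ u × y ≡ v)

DecArcSet : ∀ {N} → ArcSet N → Set
DecArcSet R = ∀ x y → Dec (R x y)

add? : ∀ {N} {R : ArcSet N} → DecArcSet R → ∀ u v → DecArcSet (Add R u v)
add? R? u v x y = R? x y ⊎-dec ((x ≟ᶠ u) ×-dec (y ≟ᶠ v))

-- The arcs xy are added in the order of their
-- index combine x y : Fin (N * N).
module _ {N : ℕ} {ℓ} (A : ArcSet N) (A? : DecArcSet A) (Inv : ArcSet N → Set ℓ)
  (shrink : ∀ {R S} → Inv R → S ⇒ R → Inv S)
  (empty  : Inv (λ _ _ → ⊥))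
  (extend : ∀ R → DecArcSet R → R ⇒ A → Inv R → ∀ u v → A u v → ¬ R u v → Inv (Add R u v))
  where

  private
    Prefix : ℕ → ArcSet N
    Prefix t x y = A x y × toℕ (combine x y) < t

    prefix? : ∀ t → DecArcSet (Prefix t)
    prefix? t x y = A? x y ×-dec (toℕ (combine x y) <? t)

    prefix-split : ∀ t u v → toℕ (combine u v) ≡ t → Prefix (suc t) ⇒ Add (Prefix t) u v
    prefix-split t u v index-uv {x} {y} (A-xy , x<t+1) with toℕ (combine x y) <? t
    ... | yes x<t = inj₁ (A-xy , x<t)
    ... | no  x≮t = inj₂ (combine-injective x y u v
                            (toℕ-injective (trans (≤-antisym (≤-pred x<t+1) (≮⇒≥ x≮t)) (sym index-uv))))

    prefix-step : ∀ t u v → toℕ (combine u v) ≡ t → Inv (Prefix t) → Inv (Prefix (suc t))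
    prefix-step t u v index-uv inv with A? u v
    ... | yes A-uv = shrink (extend (Prefix t) (prefix? t) proj₁ inv u v A-uv (λ (_ , lt) → <-irrefl index-uv lt))
                            (prefix-split t u v index-uv)
    ... | no ¬A-uv = shrink inv prefix-same
      where
      prefix-same : Prefix (suc t) ⇒ Prefix t
      prefix-same p with prefix-split t u v index-uv p
      ... | inj₁ q            = q
      ... | inj₂ (refl , refl) = ⊥-elim (¬A-uv (proj₁ p))

    prefix-all : ∀ t → t ≤ N * N → Inv (Prefix t)
    prefix-all zero    _  = shrink empty (λ ())
    prefix-all (suc t) t< = prefix-step t (proj₁ uv) (proj₂ uv) index-uv (prefix-all t (<⇒≤ t<))
      where
      uv = remQuot {N} N (fromℕ< t<)
      index-uv = trans (cong toℕ (combine-remQuot {N} N (fromℕ< t<))) (toℕ-fromℕ< t<)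

  arc-induction : Inv A
  arc-induction = shrink (prefix-all (N * N) ≤-refl) (λ {x} {y} A-xy → A-xy , toℕ<n (combine x y))

OutInjective : ∀ {N} → ArcSet N → (Fin N → Fin N → ℕ) → Set
OutInjective R ℓ = ∀ x y y' → R x y → R x y' → ℓ x y ≡ ℓ x y' → y ≡ y'

InInjective : ∀ {N} → ArcSet N → (Fin N → Fin N → ℕ) → Set
InInjective R ℓ = ∀ x x' y → R x y → R x' y → ℓ x y ≡ ℓ x' y → x ≡ x'

record ProperColouring {N : ℕ} (Δ : ℕ) (R : ArcSet N) : Set where
  field
    colour    : Fin N → Fin N → ℕ
    bounded   : ∀ x y → R x y → colour x y < Δ
    outProper : OutInjective R colour
    inProper  : InInjective R colour
open ProperColouring

restrict : ∀ {N Δ} {R S : ArcSet N} → ProperColouring Δ R → S ⇒ R → ProperColouring Δ S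
restrict κ S⊆R = record
  { colour    = colour κ
  ; bounded   = λ x y s → bounded κ x y (S⊆R s)
  ; outProper = λ x y y' s s' → outProper κ x y y' (S⊆R s) (S⊆R s')
  ; inProper  = λ x x' y s s' → inProper κ x x' y (S⊆R s) (S⊆R s')
  }

FreeAtTail : ∀ {N Δ} (R : ArcSet N) → ProperColouring Δ R → Fin N → ℕ → Set
FreeAtTail R κ u a = ∀ w → R u w → colour κ u w ≢ a

FreeAtHead : ∀ {N Δ} (R : ArcSet N) → ProperColouring Δ R → Fin N → ℕ → Set
FreeAtHead R κ v a = ∀ w → R w v → colour κ w v ≢ a

colour-new-arc : ∀ {N Δ} {R : ArcSet N} (κ : ProperColouring Δ R) {u v : Fin N} (a : ℕ) →
                 ¬ R u v → a < Δ → FreeAtTail R κ u a → FreeAtHead R κ v a →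
                 ProperColouring Δ (Add R u v)
colour-new-arc {N} {Δ} {R} κ {u} {v} a fresh a<Δ free-u free-v = record
  { colour = colour′ ; bounded = bounded′ ; outProper = outProper′ ; inProper = inProper′ }
  where
  is-new? : ∀ x y → Dec (x ≡ u × y ≡ v)
  is-new? x y = (x ≟ᶠ u) ×-dec (y ≟ᶠ v)

  colour′ : Fin N → Fin N → ℕ
  colour′ x y = if does (is-new? x y) then a else colour κ x y

  new : colour′ u v ≡ a
  new = cong (λ t → if t then a else colour κ u v) (dec-true (is-new? u v) (refl , refl))

  old : ∀ {x y} → R x y → colour′ x y ≡ colour κ x y
  old {x} {y} r = cong (λ t → if t then a else colour κ x y)
                       (dec-false (is-new? x y) (λ { (refl , refl) → fresh r }))

  bounded′ : ∀ x y → Add R u v x y → colour′ x y < Δ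
  bounded′ x y (inj₁ r)             = subst (_< Δ) (sym (old r)) (bounded κ x y r)
  bounded′ x y (inj₂ (refl , refl)) = subst (_< Δ) (sym new) a<Δ

  outProper′ : OutInjective (Add R u v) colour′
  outProper′ x y y' (inj₁ r) (inj₁ r') eq = outProper κ x y y' r r' (trans (sym (old r)) (trans eq (old r')))
  outProper′ x y y' (inj₂ (refl , refl)) (inj₂ (_ , refl)) _ = refl
  outProper′ x y y' (inj₁ r) (inj₂ (refl , refl)) eq = ⊥-elim (free-u y r (trans (sym (old r)) (trans eq new)))
  outProper′ x y y' (inj₂ (refl , refl)) (inj₁ r') eq = ⊥-elim (free-u y' r' (trans (sym (old r')) (trans (sym eq) new)))

  inProper′ : InInjective (Add R u v) colour′
  inProper′ x x' y (inj₁ r) (inj₁ r') eq = inProper κ x x' y r r' (trans (sym (old r)) (trans eq (old r')))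
  inProper′ x x' y (inj₂ (refl , refl)) (inj₂ (refl , _)) _ = refl
  inProper′ x x' y (inj₁ r) (inj₂ (refl , refl)) eq = ⊥-elim (free-v x r (trans (sym (old r)) (trans eq new)))
  inProper′ x x' y (inj₂ (refl , refl)) (inj₁ r') eq = ⊥-elim (free-v x' r' (trans (sym (old r')) (trans (sym eq) new)))

-- Follow the a/b-alternating walk starting
-- with x₀v; it never repeats an arc (b is free at v) and so stops.  Exchange
-- a and b on it.  The result is a proper colouring of the same arcs in which
-- a is free both at u and at v: the walk has no arc leaving u, because every
-- tail on the walk has an a-arc while a is free at u.
module KempeSwap {N Δ : ℕ} {R : ArcSet N} (R? : DecArcSet R) (κ : ProperColouring Δ R)
  (u v : Fin N) (a b : ℕ) (a<Δ : a < Δ) (b<Δ : b < Δ)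
  (a-free-at-u : FreeAtTail R κ u a) (b-free-at-v : FreeAtHead R κ v b)
  (x₀ : Fin N) (R-x₀v : R x₀ v) (x₀v-is-a : colour κ x₀ v ≡ a)
  where

  private
    V = Fin N

    col : V → V → ℕ
    col = colour κ

  -- a is used at v, b is not
  a≢b : a ≢ b
  a≢b a≡b = b-free-at-v x₀ R-x₀v (trans x₀v-is-a a≡b)

  AB : ℕ → Set
  AB c = c ≡ a ⊎ c ≡ b

  ABArc : V → V → Set
  ABArc x y = R x y × AB (col x y)

  not-a⇒b : ∀ {c} → AB c → c ≢ a → c ≡ b
  not-a⇒b (inj₁ c≡a) c≢a = ⊥-elim (c≢a c≡a)
  not-a⇒b (inj₂ c≡b) _   = c≡b

  data Step : V × V → V × V → Set where
    at-tail : ∀ {x y y'} → col x y ≡ a → R x y' → col x y' ≡ b → Step (x , y) (x , y')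
    at-head : ∀ {x y x'} → col x y ≢ a → R x' y → col x' y ≡ a → Step (x , y) (x' , y)

  private
    OutArc InArc : V → ℕ → Set
    OutArc x c = ∃ λ y → R x y × col x y ≡ c
    InArc  y c = ∃ λ x → R x y × col x y ≡ c

    out-arc? : ∀ x c → Dec (OutArc x c)
    out-arc? x c = any? λ y → R? x y ×-dec (col x y ≟ c)

    in-arc? : ∀ y c → Dec (InArc y c)
    in-arc? y c = any? λ x → R? x y ×-dec (col x y ≟ c)

    next-by : ∀ {x y} → Dec (col x y ≡ a) → Dec (OutArc x b) → Dec (InArc y a) → Maybe (V × V)
    next-by {x}     (yes _) (yes (y' , _)) _              = just (x , y')
    next-by         (yes _) (no _)         _              = nothing
    next-by {y = y} (no _)  _              (yes (x' , _)) = just (x' , y)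
    next-by         (no _)  _              (no _)         = nothing

  next : V × V → Maybe (V × V)
  next (x , y) = next-by (col x y ≟ a) (out-arc? x b) (in-arc? y a)

  next-sound : ∀ p {q} → next p ≡ just q → Step p q
  next-sound (x , y) = sound (col x y ≟ a) (out-arc? x b) (in-arc? y a)
    where
    sound : ∀ d₁ d₂ d₃ {q} → next-by {x} {y} d₁ d₂ d₃ ≡ just q → Step (x , y) q
    sound (yes c≡a) (yes (y' , r , c≡b)) _ refl = at-tail c≡a r c≡b
    sound (no c≢a)  _ (yes (x' , r , c≡a))  refl = at-head c≢a r c≡a
    sound (yes _) (no _) _ ()
    sound (no _)  _ (no _) ()

  -- … and, the step from an arc being unique by properness, takes every step
  next-complete : ∀ {p q} → Step p q → next p ≡ just q
  next-complete {x , y} = complete (col x y ≟ a) (out-arc? x b) (in-arc? y a)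
    where
    complete : ∀ d₁ d₂ d₃ {q} → Step (x , y) q → next-by {x} {y} d₁ d₂ d₃ ≡ just q
    complete (yes _) (yes (y'' , r'' , c'')) _ (at-tail _ r c) =
      cong (λ z → just (x , z)) (outProper κ x y'' _ r'' r (trans c'' (sym c)))
    complete (yes _)   (no none) _ (at-tail _ r c) = ⊥-elim (none (_ , r , c))
    complete (no c≢a)  _ _ (at-tail c≡a _ _)       = ⊥-elim (c≢a c≡a)
    complete (yes c≡a) _ _ (at-head c≢a _ _)       = ⊥-elim (c≢a c≡a)
    complete (no _) _ (yes (x'' , r'' , c'')) (at-head _ r c) =
      cong (λ z → just (z , y)) (inProper κ x'' _ y r'' r (trans c'' (sym c)))
    complete (no _) _ (no none) (at-head _ r c)    = ⊥-elim (none (_ , r , c))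

  step-target-AB : ∀ {p x y} → Step p (x , y) → ABArc x y
  step-target-AB (at-tail _ r c≡b) = r , inj₂ c≡b
  step-target-AB (at-head _ r c≡a) = r , inj₁ c≡a

  step-injective : ∀ {x₁ y₁ x₂ y₂ q} → ABArc x₁ y₁ → ABArc x₂ y₂ →
                   Step (x₁ , y₁) q → Step (x₂ , y₂) q → (x₁ , y₁) ≡ (x₂ , y₂)
  step-injective (r₁ , _) (r₂ , _) (at-tail c₁ _ _) (at-tail c₂ _ _) =
    cong (_ ,_) (outProper κ _ _ _ r₁ r₂ (trans c₁ (sym c₂)))
  step-injective (r₁ , ab₁) (r₂ , ab₂) (at-head n₁ _ _) (at-head n₂ _ _) =
    cong (_, _) (inProper κ _ _ _ r₁ r₂ (trans (not-a⇒b ab₁ n₁) (sym (not-a⇒b ab₂ n₂))))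
  step-injective _ _ (at-tail _ _ c≡b) (at-head _ _ c≡a) = ⊥-elim (a≢b (trans (sym c≡a) c≡b))
  step-injective _ _ (at-head _ _ c≡a) (at-tail _ _ c≡b) = ⊥-elim (a≢b (trans (sym c≡a) c≡b))

  walk : ℕ → Maybe (V × V)
  walk zero    = just (x₀ , v)
  walk (suc k) = walk k >>= next

  walk-entry : ∀ k {q} → walk (suc k) ≡ just q → ∃ λ p → walk k ≡ just p × Step p q
  walk-entry k = entry (walk k)
    where
    entry : ∀ m {q} → (m >>= next) ≡ just q → ∃ λ p → m ≡ just p × Step p q
    entry nothing  ()
    entry (just p) e = p , refl , next-sound p e

  walk-continues : ∀ k {p q} → walk k ≡ just p → Step p q → walk (suc k) ≡ just q
  walk-continues k e s = trans (cong (_>>= next) e) (next-complete s)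

  walk-AB : ∀ k {x y} → walk k ≡ just (x , y) → ABArc x y
  walk-AB zero    refl = R-x₀v , inj₁ x₀v-is-a
  walk-AB (suc k) e    = step-target-AB (proj₂ (proj₂ (walk-entry k e)))

  -- The walk never repeats an arc: it cannot return to x₀v, as x₀v would be
  -- entered by a b-arc at v, and steps are injective.
  walk-injective : ∀ i j {p} → i < j → walk i ≡ just p → walk j ≡ just p → ⊥
  walk-injective zero (suc j) _ refl e with walk-entry j e
  ... | _ , _ , at-tail _ _ c≡b = a≢b (trans (sym x₀v-is-a) c≡b)
  ... | (z , _) , e' , at-head c≢a _ _ with walk-AB j e'
  ...   | r , ab = b-free-at-v z r (not-a⇒b ab c≢a)
  walk-injective (suc i) (suc j) (s≤s i<j) eᵢ eⱼ
    with walk-entry i eᵢ | walk-entry j eⱼ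
  ... | (x₁ , y₁) , e₁ , s₁ | (x₂ , y₂) , e₂ , s₂
    with step-injective (walk-AB i e₁) (walk-AB j e₂) s₁ s₂
  ...   | refl = walk-injective i j i<j e₁ e₂

  walk-stays-stopped : ∀ d k → walk k ≡ nothing → walk (d + k) ≡ nothing
  walk-stays-stopped zero    k e = e
  walk-stays-stopped (suc d) k e = cong (_>>= next) (walk-stays-stopped d k e)

  walk-stopped-after : ∀ k j → k ≤ j → walk k ≡ nothing → walk j ≡ nothing
  walk-stopped-after k j k≤j e = subst (λ i → walk i ≡ nothing) (m∸n+n≡m k≤j) (walk-stays-stopped (j ∸ k) k e)

  -- By pigeonhole on the N * N possible arcs, the walk stops within N * N steps.
  walk-ends : walk (N * N) ≡ nothing
  walk-ends with walk (N * N) in e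
  ... | nothing = refl
  ... | just _  = ⊥-elim (no-repeat (pigeonhole (n<1+n (N * N)) (λ i → uncurry combine (arc-at i))))
    where
    -- the walk still runs at step N * N, hence at every earlier step
    defined : ∀ k → k ≤ N * N → ∃ λ p → walk k ≡ just p
    defined k k≤ with walk k in eₖ
    ... | just p  = p , refl
    ... | nothing with trans (sym e) (walk-stopped-after k (N * N) k≤ eₖ)
    ...   | ()

    arc-at : Fin (suc (N * N)) → V × V
    arc-at i = proj₁ (defined (toℕ i) (≤-pred (toℕ<n i)))

    visited-at : ∀ i → walk (toℕ i) ≡ just (arc-at i)
    visited-at i = proj₂ (defined (toℕ i) (≤-pred (toℕ<n i)))

    no-repeat : ¬ ∃₂ λ i j → i Data.Fin.< j × uncurry combine (arc-at i) ≡ uncurry combine (arc-at j)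
    no-repeat (i , j , i<j , same-code) =
      walk-injective (toℕ i) (toℕ j) i<j (visited-at i) (trans (visited-at j) (cong just (sym same-arc)))
      where
      same-arc : arc-at i ≡ arc-at j
      same-arc = uncurry (cong₂ _,_) (combine-injective _ _ _ _ same-code)

  OnWalk : V → V → Set
  OnWalk x y = ∃ λ (k : Fin (N * N)) → walk (toℕ k) ≡ just (x , y)

  onWalk? : DecArcSet OnWalk
  onWalk? x y = any? λ k → Maybe.≡-dec (Product.≡-dec _≟ᶠ_ _≟ᶠ_) (walk (toℕ k)) (just (x , y))

  -- an arc reached at any step is on the walk, as the walk stops before step N * N
  visited : ∀ k {x y} → walk k ≡ just (x , y) → OnWalk x y
  visited k e with k <? N * N
  ... | yes k< = fromℕ< k< , trans (cong walk (toℕ-fromℕ< k<)) e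
  ... | no  k≮ with trans (sym e) (walk-stopped-after (N * N) k (≮⇒≥ k≮) walk-ends)
  ...   | ()

  onWalk-AB : ∀ {x y} → OnWalk x y → ABArc x y
  onWalk-AB (k , e) = walk-AB (toℕ k) e

  b-arc-entry : ∀ k {x y} → walk k ≡ just (x , y) → col x y ≡ b → ∃ λ z → OnWalk x z × col x z ≡ a
  b-arc-entry zero refl c≡b = ⊥-elim (a≢b (trans (sym x₀v-is-a) c≡b))
  b-arc-entry (suc k) e c≡b with walk-entry k e
  ... | (_ , z) , e' , at-tail c≡a _ _ = z , visited k e' , c≡a
  ... | _ , _ , at-head _ _ c≡a        = ⊥-elim (a≢b (trans (sym c≡a) c≡b))

  a-arc-entry : ∀ k {x y} → walk (suc k) ≡ just (x , y) → col x y ≡ a → ∃ λ z → OnWalk z y × col z y ≡ b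
  a-arc-entry k e c≡a with walk-entry k e
  ... | _ , _ , at-tail _ _ c≡b         = ⊥-elim (a≢b (trans (sym c≡a) c≡b))
  ... | (z , _) , e' , at-head c≢a _ _ = z , visited k e' , not-a⇒b (proj₂ (walk-AB k e')) c≢a

  tail-has-a : ∀ {x y} → OnWalk x y → ∃ λ z → R x z × col x z ≡ a
  tail-has-a {x} {y} (k , e) with walk-AB (toℕ k) e
  ... | r , inj₁ c≡a = y , r , c≡a
  ... | _ , inj₂ c≡b with b-arc-entry (toℕ k) e c≡b
  ...   | z , on , c≡a = z , proj₁ (onWalk-AB on) , c≡a

  closed-at-tail : ∀ {x y y'} → OnWalk x y → ABArc x y' → OnWalk x y'
  closed-at-tail {x} {y} {y'} (k , e) (r' , ab') with walk-AB (toℕ k) e | ab'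
  ... | r , inj₁ c≡a | inj₁ c'≡a = subst (OnWalk x) (outProper κ x y y' r r' (trans c≡a (sym c'≡a))) (k , e)
  ... | r , inj₂ c≡b | inj₂ c'≡b = subst (OnWalk x) (outProper κ x y y' r r' (trans c≡b (sym c'≡b))) (k , e)
  ... | r , inj₁ c≡a | inj₂ c'≡b = visited (suc (toℕ k)) (walk-continues (toℕ k) e (at-tail c≡a r' c'≡b))
  ... | r , inj₂ c≡b | inj₁ c'≡a with b-arc-entry (toℕ k) e c≡b
  ...   | z , on , cz≡a = subst (OnWalk x) (outProper κ x z y' (proj₁ (onWalk-AB on)) r' (trans cz≡a (sym c'≡a))) on

  closed-at-head : ∀ {x x' y} → OnWalk x y → ABArc x' y → OnWalk x' y
  closed-at-head {x} {x'} {y} (k , e) (r' , ab') = closed (toℕ k) e (walk-AB (toℕ k) e) ab'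
    where
    closed : ∀ k → walk k ≡ just (x , y) → ABArc x y → AB (col x' y) → OnWalk x' y
    closed k e (r , inj₁ c≡a) (inj₁ c'≡a) =
      subst (λ z → OnWalk z y) (inProper κ x x' y r r' (trans c≡a (sym c'≡a))) (visited k e)
    closed k e (r , inj₂ c≡b) (inj₂ c'≡b) =
      subst (λ z → OnWalk z y) (inProper κ x x' y r r' (trans c≡b (sym c'≡b))) (visited k e)
    closed k e (r , inj₂ c≡b) (inj₁ c'≡a) =
      visited (suc k) (walk-continues k e (at-head (λ c≡a → a≢b (trans (sym c≡a) c≡b)) r' c'≡a))
    closed zero refl (_ , inj₁ _) (inj₂ c'≡b) = ⊥-elim (b-free-at-v x' r' c'≡b)
    closed (suc k) e (_ , inj₁ c≡a) (inj₂ c'≡b) with a-arc-entry k e c≡a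
    ... | z , on , cz≡b =
      subst (λ w → OnWalk w y) (inProper κ z x' y (proj₁ (onWalk-AB on)) r' (trans cz≡b (sym c'≡b))) on

  -- The only a-arc entering v is x₀v, which is on the walk.
  a-into-v-on-walk : ∀ w → R w v → col w v ≡ a → OnWalk w v
  a-into-v-on-walk w r c≡a =
    subst (λ z → OnWalk z v) (inProper κ x₀ w v R-x₀v r (trans x₀v-is-a (sym c≡a))) (visited 0 refl)

  -- Exchange of a and b (on the colours a and b; the value elsewhere is irrelevant).
  other : ℕ → ℕ
  other c = if does (c ≟ a) then b else a

  other-AB : ∀ c → AB (other c)
  other-AB c = by-cases (does (c ≟ a))
    where
    by-cases : ∀ t → AB (if t then b else a)
    by-cases true  = inj₂ refl
    by-cases false = inj₁ refl

  other-a : other a ≡ b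
  other-a = cong (λ t → if t then b else a) (dec-true (a ≟ a) refl)

  other-b : other b ≡ a
  other-b = cong (λ t → if t then b else a) (dec-false (b ≟ a) (λ b≡a → a≢b (sym b≡a)))

  other-injective : ∀ {c c'} → AB c → AB c' → other c ≡ other c' → c ≡ c'
  other-injective (inj₁ refl) (inj₁ refl) _  = refl
  other-injective (inj₂ refl) (inj₂ refl) _  = refl
  other-injective (inj₁ refl) (inj₂ refl) eq = ⊥-elim (a≢b (trans (sym other-b) (trans (sym eq) other-a)))
  other-injective (inj₂ refl) (inj₁ refl) eq = ⊥-elim (a≢b (trans (sym other-b) (trans eq other-a)))

  swapped-colour : V → V → ℕ
  swapped-colour x y = if does (onWalk? x y) then other (col x y) else col x y

  on-walk : ∀ {x y} → OnWalk x y → swapped-colour x y ≡ other (col x y)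
  on-walk {x} {y} on = cong (λ t → if t then other (col x y) else col x y) (dec-true (onWalk? x y) on)

  off-walk : ∀ {x y} → ¬ OnWalk x y → swapped-colour x y ≡ col x y
  off-walk {x} {y} off = cong (λ t → if t then other (col x y) else col x y) (dec-false (onWalk? x y) off)

  swap-reflects-equality : ∀ {x y x' y'} → R x y → R x' y' →
    (OnWalk x y → ABArc x' y' → OnWalk x' y') → (OnWalk x' y' → ABArc x y → OnWalk x y) →
    swapped-colour x y ≡ swapped-colour x' y' → col x y ≡ col x' y'
  swap-reflects-equality {x} {y} {x'} {y'} r r' to' to eq = by-cases (onWalk? x y) (onWalk? x' y')
    where
    by-cases : Dec (OnWalk x y) → Dec (OnWalk x' y') → col x y ≡ col x' y'
    by-cases (yes on) (yes on') =
      other-injective (proj₂ (onWalk-AB on)) (proj₂ (onWalk-AB on')) (trans (sym (on-walk on)) (trans eq (on-walk on')))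
    by-cases (yes on) (no off') =
      ⊥-elim (off' (to' on (r' , subst AB (trans (sym (on-walk on)) (trans eq (off-walk off'))) (other-AB (col x y)))))
    by-cases (no off) (yes on') =
      ⊥-elim (off (to on' (r , subst AB (trans (sym (on-walk on')) (trans (sym eq) (off-walk off))) (other-AB (col x' y')))))
    by-cases (no off) (no off') = trans (sym (off-walk off)) (trans eq (off-walk off'))

  swapped : ProperColouring Δ R
  swapped = record
    { colour    = swapped-colour
    ; bounded   = bounded′
    ; outProper = λ x y y' r r' eq → outProper κ x y y' r r'
                    (swap-reflects-equality r r' closed-at-tail closed-at-tail eq)
    ; inProper  = λ x x' y r r' eq → inProper κ x x' y r r'
                    (swap-reflects-equality r r' closed-at-head closed-at-head eq)
    }
    where
    AB<Δ : ∀ {c} → AB c → c < Δ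
    AB<Δ (inj₁ refl) = a<Δ
    AB<Δ (inj₂ refl) = b<Δ

    bounded′ : ∀ x y → R x y → swapped-colour x y < Δ
    bounded′ x y r = by-cases (onWalk? x y)
      where
      by-cases : Dec (OnWalk x y) → swapped-colour x y < Δ
      by-cases (yes on)  = subst (_< Δ) (sym (on-walk on)) (AB<Δ (other-AB (col x y)))
      by-cases (no  off) = subst (_< Δ) (sym (off-walk off)) (bounded κ x y r)

  -- The walk has no arc leaving u, so a stays free at u.
  swapped-a-free-at-u : FreeAtTail R swapped u a
  swapped-a-free-at-u w r = by-cases (onWalk? u w)
    where
    by-cases : Dec (OnWalk u w) → swapped-colour u w ≢ a
    by-cases (yes on)  _  = let (z , r-uz , c≡a) = tail-has-a on in a-free-at-u z r-uz c≡a
    by-cases (no  off) eq = a-free-at-u w r (trans (sym (off-walk off)) eq)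

  -- x₀v, the only a-arc entering v, becomes a b-arc, and no arc enters v with b.
  swapped-a-free-at-v : FreeAtHead R swapped v a
  swapped-a-free-at-v w r = by-cases (onWalk? w v)
    where
    by-cases : Dec (OnWalk w v) → swapped-colour w v ≢ a
    by-cases (no  off) eq = off (a-into-v-on-walk w r (trans (sym (off-walk off)) eq))
    by-cases (yes on)  eq with proj₂ (onWalk-AB on)
    ... | inj₁ c≡a = a≢b (trans (sym eq) (trans (on-walk on) (trans (cong other c≡a) other-a)))
    ... | inj₂ c≡b = b-free-at-v w r c≡b

index-injective : ∀ {A : Set} {x y : A} {xs : List A} (p : x ∈ xs) (q : y ∈ xs) → index p ≡ index q → x ≡ y
index-injective (here refl) (here refl) _  = refl
index-injective (there p)   (there q)   eq = index-injective p q (fsuc-injective eq)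
index-injective (here _)    (there _)   ()
index-injective (there _)   (here _)    ()

count-injection : ∀ {N m} (P : Fin N → Bool) (f : Fin m → Fin N) → (∀ i j → f i ≡ f j → i ≡ j) →
                  (∀ i → T (P (f i))) → m ≤ length (filter (λ w → T? (P w)) (allFin N))
count-injection P f f-injective P-f =
  injective⇒≤ {f = λ i → index (member i)} (λ {i} {j} eq → f-injective i j (index-injective (member i) (member j) eq))
  where
  member : ∀ i → f i ∈ filter (λ w → T? (P w)) (allFin _)
  member i = ∈-filter⁺ (λ w → T? (P w)) (∈-allFin (f i)) (P-f i)

free-value : ∀ {N} Δ (S : Fin N → Bool) (U : Fin N → Set) → (∀ w → Dec (U w)) → (g : Fin N → ℕ) →
             (∀ w → U w → T (S w)) → (v : Fin N) → T (S v) → ¬ U v →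
             (∀ w w' → U w → U w' → g w ≡ g w' → w ≡ w') →
             length (filter (λ w → T? (S w)) (allFin N)) ≤ Δ →
             ∃ λ a → a < Δ × (∀ w → U w → g w ≢ a)
free-value {N} Δ S U U? g U⊆S v S-v ¬U-v g-injective few
  with all? (λ (c : Fin Δ) → any? (λ w → U? w ×-dec (g w ≟ toℕ c)))
... | no some-free with ¬∀⟶∃¬ Δ _ (λ c → any? (λ w → U? w ×-dec (g w ≟ toℕ c))) some-free
...   | c , c-free = toℕ c , toℕ<n c , λ w U-w g≡c → c-free (w , U-w , g≡c)
free-value {N} Δ S U U? g U⊆S v S-v ¬U-v g-injective few | yes all-used =
  ⊥-elim (<⇒≱ (n<1+n Δ) (≤-trans (count-injection S f f-injective S-f) few))
  where
  -- v together with one vertex of U for each value c < Δ: Δ + 1 vertices in S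
  f : Fin (suc Δ) → Fin N
  f zero    = v
  f (suc c) = proj₁ (all-used c)

  S-f : ∀ i → T (S (f i))
  S-f zero    = S-v
  S-f (suc c) = U⊆S _ (proj₁ (proj₂ (all-used c)))

  f-injective : ∀ i j → f i ≡ f j → i ≡ j
  f-injective zero    zero     _  = refl
  f-injective zero    (suc c)  eq = ⊥-elim (¬U-v (subst U (sym eq) (proj₁ (proj₂ (all-used c)))))
  f-injective (suc c) zero     eq = ⊥-elim (¬U-v (subst U eq (proj₁ (proj₂ (all-used c)))))
  f-injective (suc c) (suc c') eq =
    cong suc (toℕ-injective (trans (sym (proj₂ (proj₂ (all-used c)))) (trans (cong g eq) (proj₂ (proj₂ (all-used c'))))))

≤-foldr-⊔ : ∀ (xs : List ℕ) {x} → x ∈ xs → x ≤ foldr _⊔_ 0 xs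
≤-foldr-⊔ (y ∷ ys) (here refl) = m≤m⊔n y _
≤-foldr-⊔ (y ∷ ys) (there x∈)  = ≤-trans (≤-foldr-⊔ ys x∈) (m≤n⊔m y _)

degrees≤Δ* : ∀ D u → outdeg D u ⊔ indeg D u ≤ Δ* D
degrees≤Δ* D u = ≤-foldr-⊔ _ (∈-map⁺ (λ w → outdeg D w ⊔ indeg D w) (∈-allFin u))

outdeg≤Δ* : ∀ D u → outdeg D u ≤ Δ* D
outdeg≤Δ* D u = ≤-trans (m≤m⊔n _ _) (degrees≤Δ* D u)

indeg≤Δ* : ∀ D u → indeg D u ≤ Δ* D
indeg≤Δ* D u = ≤-trans (m≤n⊔m _ _) (degrees≤Δ* D u)

arc? : ∀ D → DecArcSet (Arc D)
arc? D x y = arc D x y ≟ᵇ true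

T-arc : ∀ D {x y} → Arc D x y → T (arc D x y)
T-arc D = Equivalence.from T-≡

-- A proper colouring of R ⊆ A(D) with Δ*(D) colours extends to any further
-- arc uv: pick a colour a free at u and b free at v (they exist since the
-- degrees are at most Δ*); if a is used at v, first swap the a/b-walk.
König-step : ∀ D (R : ArcSet (n D)) → DecArcSet R → R ⇒ Arc D → ProperColouring (Δ* D) R →
             ∀ u v → Arc D u v → ¬ R u v → ProperColouring (Δ* D) (Add R u v)
König-step D R R? R⊆A κ u v uv fresh = extend free-at-u free-at-v
  where
  free-at-u : ∃ λ a → a < Δ* D × FreeAtTail R κ u a
  free-at-u = free-value (Δ* D) (arc D u) (R u) (R? u) (colour κ u) (λ w r → T-arc D (R⊆A r))
                         v (T-arc D uv) fresh (outProper κ u) (outdeg≤Δ* D u)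

  free-at-v : ∃ λ b → b < Δ* D × FreeAtHead R κ v b
  free-at-v = free-value (Δ* D) (λ w → arc D w v) (λ w → R w v) (λ w → R? w v) (λ w → colour κ w v)
                         (λ w r → T-arc D (R⊆A r)) u (T-arc D uv) fresh (λ w w' → inProper κ w w' v) (indeg≤Δ* D v)

  extend : (∃ λ a → a < Δ* D × FreeAtTail R κ u a) → (∃ λ b → b < Δ* D × FreeAtHead R κ v b) →
           ProperColouring (Δ* D) (Add R u v)
  extend (a , a<Δ , a-free-at-u) (b , b<Δ , b-free-at-v) with any? (λ x → R? x v ×-dec (colour κ x v ≟ a))
  ... | no a-unused = colour-new-arc κ a fresh a<Δ a-free-at-u (λ w r c≡a → a-unused (w , r , c≡a))
  ... | yes (x₀ , R-x₀v , x₀v-is-a) =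
    colour-new-arc swapped a fresh a<Δ swapped-a-free-at-u swapped-a-free-at-v
    where open KempeSwap R? κ u v a b a<Δ b<Δ a-free-at-u b-free-at-v x₀ R-x₀v x₀v-is-a

no-arcs : ∀ {N} Δ → ProperColouring {N} Δ (λ _ _ → ⊥)
no-arcs Δ = record { colour = λ _ _ → 0 ; bounded = λ _ _ () ; outProper = λ _ _ _ () ; inProper = λ _ _ _ () }

-- König's theorem for digraphs (the bipartite edge-colouring theorem for the
-- graph of tails versus heads): the arcs have a proper Δ*-colouring.
König : ∀ D → ProperColouring (Δ* D) (Arc D)
König D = arc-induction (Arc D) (arc? D) (ProperColouring (Δ* D))
                        restrict (no-arcs (Δ* D)) (König-step D)

module Representatives {N : ℕ} (A : ArcSet N) (τ : Fin N → Fin N → ℕ) where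

  Represented : ArcSet N → Fin N → Fin N → Set
  Represented M x y = (∃ λ y' → M x y' × τ x y' ≡ τ x y) ⊎ (∃ λ x' → M x' y × τ x' y ≡ τ x y)

  represented? : ∀ {M} → DecArcSet M → DecArcSet (Represented M)
  represented? M? x y = any? (λ y' → M? x y' ×-dec (τ x y' ≟ τ x y))
                  ⊎-dec any? (λ x' → M? x' y ×-dec (τ x' y ≟ τ x y))

  represented-mono : ∀ {M M'} → M ⇒ M' → ∀ x y → Represented M x y → Represented M' x y
  represented-mono M⊆M' x y (inj₁ (y' , m , eq)) = inj₁ (y' , M⊆M' m , eq)
  represented-mono M⊆M' x y (inj₂ (x' , m , eq)) = inj₂ (x' , M⊆M' m , eq)

  record Representing (R : ArcSet N) : Set₁ where
    field
      M           : ArcSet N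
      M?          : DecArcSet M
      M⊆A         : M ⇒ A
      outDistinct : OutInjective M τ
      inDistinct  : InInjective M τ
      represents  : ∀ x y → R x y → Represented M x y

  reuse : ∀ {R S} (ρ : Representing R) → (∀ x y → S x y → Represented (Representing.M ρ) x y) → Representing S
  reuse ρ rep = record
    { M = M ; M? = M? ; M⊆A = M⊆A ; outDistinct = outDistinct ; inDistinct = inDistinct ; represents = rep }
    where open Representing ρ

  representing-step : ∀ R → DecArcSet R → R ⇒ A → Representing R →
                      ∀ u v → A u v → ¬ R u v → Representing (Add R u v)
  representing-step R _ _ ρ u v uv _ with represented? (Representing.M? ρ) u v
  ... | yes uv-rep = reuse ρ λ { x y (inj₁ r) → represents x y r ; _ _ (inj₂ (refl , refl)) → uv-rep }
    where open Representing ρ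
  ... | no ¬uv-rep = record
    { M           = Add M u v
    ; M?          = add? M? u v
    ; M⊆A         = λ { (inj₁ m) → M⊆A m ; (inj₂ (refl , refl)) → uv }
    ; outDistinct = outDistinct′
    ; inDistinct  = inDistinct′
    ; represents  = λ { x y (inj₁ r) → represented-mono inj₁ x y (represents x y r)
                      ; _ _ (inj₂ (refl , refl)) → inj₁ (v , inj₂ (refl , refl) , refl) }
    }
    where
    open Representing ρ

    outDistinct′ : OutInjective (Add M u v) τ
    outDistinct′ x y y' (inj₁ m) (inj₁ m') eq = outDistinct x y y' m m' eq
    outDistinct′ x y y' (inj₂ (refl , refl)) (inj₂ (_ , refl)) _ = refl
    outDistinct′ x y y' (inj₁ m) (inj₂ (refl , refl)) eq = ⊥-elim (¬uv-rep (inj₁ (y , m , eq)))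
    outDistinct′ x y y' (inj₂ (refl , refl)) (inj₁ m') eq = ⊥-elim (¬uv-rep (inj₁ (y' , m' , sym eq)))

    inDistinct′ : InInjective (Add M u v) τ
    inDistinct′ x x' y (inj₁ m) (inj₁ m') eq = inDistinct x x' y m m' eq
    inDistinct′ x x' y (inj₂ (refl , refl)) (inj₂ (refl , _)) _ = refl
    inDistinct′ x x' y (inj₁ m) (inj₂ (refl , refl)) eq = ⊥-elim (¬uv-rep (inj₂ (x , m , eq)))
    inDistinct′ x x' y (inj₂ (refl , refl)) (inj₁ m') eq = ⊥-elim (¬uv-rep (inj₂ (x' , m' , sym eq)))

  representing : DecArcSet A → Representing A
  representing A? = arc-induction A A? Representing
    (λ ρ S⊆R → reuse ρ (λ x y s → Representing.represents ρ x y (S⊆R s)))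
    (record { M = λ _ _ → ⊥ ; M? = λ _ _ → no (λ ()) ; M⊆A = λ ()
            ; outDistinct = λ _ _ _ () ; inDistinct = λ _ _ _ () ; represents = λ _ _ () })
    representing-step

module Distinguishing (D : Digraph) (L : ℕ) (0<L : 0 < L) (τ : Fin (n D) → Fin (n D) → ℕ)
  (τ<L : ∀ x y → Arc D x y → τ x y < L)
  (consecutive-differ : ∀ w u v → Arc D w u → Arc D u v → τ w u ≢ τ u v)
  (κ : ProperColouring (Δ* D) (Arc D))
  (ρ : Representatives.Representing (Arc D) τ (Arc D))
  where

  private
    V = Fin (n D)
    Δ = Δ* D
    m = Δ + L

  open Representatives (Arc D) τ using (Representing)
  open Representing ρ

  shade : V → V → ℕ
  shade x y = if does (M? x y) then Δ + τ x y else colour κ x y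

  shade-M : ∀ {x y} → M x y → shade x y ≡ Δ + τ x y
  shade-M {x} {y} m-xy = cong (λ t → if t then Δ + τ x y else colour κ x y) (dec-true (M? x y) m-xy)

  shade-not-M : ∀ {x y} → ¬ M x y → shade x y ≡ colour κ x y
  shade-not-M {x} {y} ¬m-xy = cong (λ t → if t then Δ + τ x y else colour κ x y) (dec-false (M? x y) ¬m-xy)

  shade-cases : ∀ x y → Arc D x y → (M x y × shade x y ≡ Δ + τ x y) ⊎ (shade x y ≡ colour κ x y × colour κ x y < Δ)
  shade-cases x y xy = by-cases (M? x y)
    where
    by-cases : Dec (M x y) → (M x y × shade x y ≡ Δ + τ x y) ⊎ (shade x y ≡ colour κ x y × colour κ x y < Δ)
    by-cases (yes m-xy) = inj₁ (m-xy , shade-M m-xy)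
    by-cases (no ¬m-xy) = inj₂ (shade-not-M ¬m-xy , bounded κ x y xy)

  -- shades of arcs are below m, so reducing them modulo m loses nothing
  shade<m : ∀ x y → Arc D x y → shade x y < m
  shade<m x y xy with shade-cases x y xy
  ... | inj₁ (_ , eq)   = subst (_< m) (sym eq) (+-monoʳ-< Δ (τ<L x y xy))
  ... | inj₂ (eq , κ<Δ) = subst (_< m) (sym eq) (≤-trans κ<Δ (m≤m+n Δ L))

  high-shade : ∀ x y {t} → Arc D x y → shade x y ≡ Δ + t → M x y × τ x y ≡ t
  high-shade x y xy eq with shade-cases x y xy
  ... | inj₁ (m-xy , eq′) = m-xy , +-cancelˡ-≡ Δ _ _ (trans (sym eq′) eq)
  ... | inj₂ (eq′ , κ<Δ)  = ⊥-elim (<⇒≱ κ<Δ (subst (Δ ≤_) (trans (sym eq) eq′) (m≤m+n Δ _)))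

  same-shade : ∀ x y x' y' → Arc D x y → Arc D x' y' → shade x y ≡ shade x' y' →
               (M x y × M x' y' × τ x y ≡ τ x' y') ⊎ colour κ x y ≡ colour κ x' y'
  same-shade x y x' y' xy xy' eq with shade-cases x y xy | shade-cases x' y' xy'
  ... | inj₁ (m-xy , e) | _ = let (m' , τ≡) = high-shade x' y' xy' (trans (sym eq) e) in inj₁ (m-xy , m' , sym τ≡)
  ... | inj₂ _ | inj₁ (m' , e') = let (m-xy , τ≡) = high-shade x y xy (trans eq e') in inj₁ (m-xy , m' , τ≡)
  ... | inj₂ (e , _) | inj₂ (e' , _) = inj₂ (trans (sym e) (trans eq e'))

  instance
    m-nonZero : NonZero m
    m-nonZero = >-nonZero (≤-trans 0<L (m≤n+m L Δ))

  γ : ArcColouring D m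
  γ x y = shade x y mod m

  γ-reflects : ∀ x y x' y' → Arc D x y → Arc D x' y' → γ x y ≡ γ x' y' → shade x y ≡ shade x' y'
  γ-reflects x y x' y' xy xy' eq = trans (sym (as-number x y xy)) (trans (cong toℕ eq) (as-number x' y' xy'))
    where
    as-number : ∀ x y → Arc D x y → toℕ (γ x y) ≡ shade x y
    as-number x y xy = trans (toℕ-fromℕ< (m%n<n (shade x y) m)) (m<n⇒m%n≡m (shade<m x y xy))

  -- equal colours at a common tail or head would contradict properness of τ on M or of κ
  γ-proper : Proper D γ
  γ-proper = out , in′
    where
    out : ∀ u v w → Arc D u v → Arc D u w → v ≢ w → γ u v ≢ γ u w
    out u v w uv uw v≢w eq with same-shade u v u w uv uw (γ-reflects u v u w uv uw eq)
    ... | inj₁ (m-uv , m-uw , τ≡) = v≢w (outDistinct u v w m-uv m-uw τ≡)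
    ... | inj₂ κ≡                 = v≢w (outProper κ u v w uv uw κ≡)

    in′ : ∀ u v w → Arc D u w → Arc D v w → u ≢ v → γ u w ≢ γ v w
    in′ u v w uw vw u≢v eq with same-shade u w v w uw vw (γ-reflects u w v w uw vw eq)
    ... | inj₁ (m-uw , m-vw , τ≡) = u≢v (inDistinct u v w m-uw m-vw τ≡)
    ... | inj₂ κ≡                  = u≢v (inProper κ u v w uw vw κ≡)

  -- If uv is represented by an M-arc uy' with the label of uv, then the same
  -- colour must appear on an arc vz, which is then an M-arc with that label;
  -- symmetrically for an M-arc x'v.  Either way two consecutive arcs would
  -- carry the same label.
  γ-distinguishing : NeighbourDistinguishing D γ
  γ-distinguishing u v uv (same-out , same-in) with represents u v uv
  ... | inj₁ (y' , m-uy' , τ≡) =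
    let (z , vz , γ≡) = Equivalence.to (same-out (γ u y')) (y' , M⊆A m-uy' , refl)
        (_ , τ-vz≡) = high-shade v z vz (trans (γ-reflects v z u y' vz (M⊆A m-uy') γ≡) (shade-M m-uy'))
    in consecutive-differ u v z uv vz (sym (trans τ-vz≡ τ≡))
  ... | inj₂ (x' , m-x'v , τ≡) =
    let (w , wu , γ≡) = Equivalence.from (same-in (γ x' v)) (x' , M⊆A m-x'v , refl)
        (_ , τ-wu≡) = high-shade w u wu (trans (γ-reflects w u x' v wu (M⊆A m-x'v) γ≡) (shade-M m-x'v))
    in consecutive-differ w u v wu uv (trans τ-wu≡ τ≡)

  ndi-bound : ndi≤ D (Δ* D + L)
  ndi-bound = γ , γ-proper , γ-distinguishing

arc⇒edge : ∀ D {x y} → Arc D x y → Edge D x y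
arc⇒edge D {x} {y} xy = cong (_∨ arc D y x) xy

⌈log₂⌉-positive : ∀ {k} → 2 ≤ k → 0 < ⌈log₂ k ⌉
⌈log₂⌉-positive {k} 2≤k = n≢0⇒n>0 λ log≡0 → <⇒≱ 2≤k (subst (λ q → k ≤ 2 ^ q) log≡0 (≤2^⌈log₂⌉ k))

-- The theorem, with τ the digit labels of a proper k-colouring (only
-- k-colourability for some k ≥ 2 is used).
corollary10 : (D : Digraph) (k : ℕ) → 3 ≤ k → HasChromaticNumber D k →
    ndi≤ D (Δ* D + 2 * ⌈log₂ k ⌉)
corollary10 D k 3≤k ((c , c-proper) , _) =
  Distinguishing.ndi-bound D (2 * p) 0<2p label label<2p consecutive-labels-differ
    (König D) (Representatives.representing (Arc D) label (arc? D))
  where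
  p = ⌈log₂ k ⌉

  0<2p : 0 < 2 * p
  0<2p = ≤-trans (⌈log₂⌉-positive (≤-trans (n≤1+n 2) 3≤k)) (m≤m+n p (1 * p))

  open DigitLabels D p (λ x → toℕ (c x)) (λ x → ≤-trans (toℕ<n (c x)) (≤2^⌈log₂⌉ k))
                   (λ x y xy same → c-proper x y (arc⇒edge D xy) (toℕ-injective same))
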